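{- Every transitive game with activeness is canonical.
   Context: Let $\mathcal{B}=\{0,1\}$. Define $\mathbb{I}_0=\{\emptyset\}\times\mathcal{B}$ and $\mathbb{I}_n=2^{\mathbb{I}_{n-1}}\times\mathcal{B}$ for $n\ge1$; a game with activeness is an element of $\mathbb{I}=\bigcup_{n\ge0}\mathbb{I}_n$. A pair $(G,g)$ is written $G^g$; elements of $G$ are its options, $g=1$ meaning active. The outcome $o$ is defined recursively: $o(G^g)=\mathscr{N}$ if $g=1$ and some option has outcome $\mathscr{P}$, and $o(G^g)=\mathscr{P}$ otherwise. The sum is $G^g+H^h=(\{G'^{g'}+H^h:G'^{g'}\in G^g\}\cup\{G^g+H'^{h'}:H'^{h'}\in H^h\})^{\max\{g,h\}}$. $G^g=H^h$ means $o(G^g+X^x)=o(H^h+X^x)$ for all games $X^x$. An option $G'^{g'}$ of $G^g$ is reversible if some $G''^{g''}\in G'^{g'}$ satisfies $G''^{g''}=G^g$; a game is canonical (recursively) if all its options are canonical and none of its options is reversible. A game $G^g$ is transitive (recursively) if every option of $G^g$ is transitive and $G'\subseteq G$ for every option $G'^{g'}\in G^g$. -}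

module Defs where

open import Data.Bool using (Bool; true; false; _∧_; _∨_; not)
open import Data.List using (List; []; _∷_; _++_)
open import Data.List.Membership.Propositional using (_∈_)
open import Data.Product using (Σ; _×_; _,_)
open import Relation.Binary.PropositionalEquality using (_≡_)
open import Relation.Nullary using (¬_)

-- A game with activeness G^g: a finite collection of options (a list,
-- read as a set: order and multiplicity are irrelevant, see _≅_) and an
-- activeness bit g (true = active).
data Game : Set where
  mk : List Game → Bool → Game

opts : Game → List Game
opts (mk gs _) = gs

act : Game → Bool
act (mk _ a) = a

data _≅_ : Game → Game → Set where
  ≅mk : ∀ {gs hs a b} → a ≡ b
      → (∀ {x} → x ∈ gs → Σ Game λ y → (y ∈ hs) × (x ≅ y))
      → (∀ {y} → y ∈ hs → Σ Game λ x → (x ∈ gs) × (x ≅ y))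
      → mk gs a ≅ mk hs b

_⊆ᵍ_ : List Game → List Game → Set
gs ⊆ᵍ hs = ∀ {x} → x ∈ gs → Σ Game λ y → (y ∈ hs) × (x ≅ y)

-- Outcome: isP G = true iff o(G) = 𝒫; o(G) = 𝒩 iff G active and some
-- option has outcome 𝒫.
mutual
  isP : Game → Bool
  isP (mk gs a) = not (a ∧ anyP gs)

  anyP : List Game → Bool
  anyP [] = false
  anyP (g ∷ gs) = isP g ∨ anyP gs

mutual
  infixl 6 _⊕_
  _⊕_ : Game → Game → Game
  G@(mk gs a) ⊕ H@(mk hs b) = mk (leftOpts gs H ++ rightOpts G hs) (a ∨ b)

  leftOpts : List Game → Game → List Game
  leftOpts [] H = []
  leftOpts (G' ∷ gs) H = (G' ⊕ H) ∷ leftOpts gs H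

  rightOpts : Game → List Game → List Game
  rightOpts G [] = []
  rightOpts G (H' ∷ hs) = (G ⊕ H') ∷ rightOpts G hs

_≈ᵍ_ : Game → Game → Set
G ≈ᵍ H = ∀ X → isP (G ⊕ X) ≡ isP (H ⊕ X)

Reversible : Game → Game → Set
Reversible G G' = Σ Game λ G'' → (G'' ∈ opts G') × (G'' ≈ᵍ G)

data Canonical : Game → Set where
  canonical : ∀ {G}
    → (∀ {G'} → G' ∈ opts G → Canonical G')
    → (∀ {G'} → G' ∈ opts G → ¬ Reversible G G')
    → Canonical G

data Transitive : Game → Set where
  transitive : ∀ {G}
    → (∀ {G'} → G' ∈ opts G → Transitive G')
    → (∀ {G'} → G' ∈ opts G → opts G' ⊆ᵍ opts G)
    → Transitive G

-- Let ∗ be the active game with no options. For any game H, the second player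
-- wins H + (H + ∗) by mirroring: ∗ keeps every position active, so the copied
-- move is always a winning reply. Hence H + (H + ∗) is a 𝒫-position, while
-- G + (H + ∗) is an 𝒩-position whenever G has an option identical to H, since
-- moving to that option reaches a 𝒫-position. So no game equals one of its
-- options. In a transitive game G, an option G'' of an option of G is itself
-- an option of G, so G'' = G is impossible and no option of G is reversible.
module Submission where

open import Defs
open import Data.Bool using (true; false)
open import Data.Bool.Properties using (∨-zeroʳ)
open import Data.List using ([]; _∷_; _++_; map)
open import Data.List.Membership.Propositional using (_∈_)
open import Data.List.Membership.Propositional.Properties
  using (∈-++⁺ˡ; ∈-++⁺ʳ; ∈-++⁻; ∈-map⁺; ∈-map⁻)
open import Data.List.Relation.Unary.Any using (here; there)
open import Data.Product using (Σ; _×_; _,_)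
open import Data.Sum using (_⊎_; inj₁; inj₂)
open import Relation.Binary.PropositionalEquality using (_≡_; refl; sym; cong; module ≡-Reasoning)
open ≡-Reasoning
open import Relation.Nullary using (¬_)

∗ : Game
∗ = mk [] true

≅-refl : ∀ G → G ≅ G
≅-refl-∈ : ∀ {G} gs → G ∈ gs → G ≅ G

≅-refl (mk gs a) = ≅mk refl (λ {x} i → x , i , ≅-refl-∈ gs i) (λ {y} i → y , i , ≅-refl-∈ gs i)

≅-refl-∈ (g ∷ gs) (here refl) = ≅-refl g
≅-refl-∈ (g ∷ gs) (there i)   = ≅-refl-∈ gs i

≅-sym : ∀ {G H} → G ≅ H → H ≅ G
≅-sym (≅mk refl f g) =
  ≅mk refl (λ i → let x , m , e = g i in x , m , ≅-sym e)
           (λ i → let y , m , e = f i in y , m , ≅-sym e)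

leftOpts≡map : ∀ gs H → leftOpts gs H ≡ map (_⊕ H) gs
leftOpts≡map []       H = refl
leftOpts≡map (g ∷ gs) H = cong (g ⊕ H ∷_) (leftOpts≡map gs H)

rightOpts≡map : ∀ G hs → rightOpts G hs ≡ map (G ⊕_) hs
rightOpts≡map G []       = refl
rightOpts≡map G (h ∷ hs) = cong (G ⊕ h ∷_) (rightOpts≡map G hs)

opts-⊕ : ∀ G H → opts (G ⊕ H) ≡ map (_⊕ H) (opts G) ++ map (G ⊕_) (opts H)
opts-⊕ G@(mk gs a) H@(mk hs b) rewrite leftOpts≡map gs H | rightOpts≡map G hs = refl

∈-⊕⁺ˡ : ∀ {G'} G H → G' ∈ opts G → G' ⊕ H ∈ opts (G ⊕ H)
∈-⊕⁺ˡ G H i rewrite opts-⊕ G H = ∈-++⁺ˡ (∈-map⁺ (_⊕ H) i)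

∈-⊕⁺ʳ : ∀ {H'} G H → H' ∈ opts H → G ⊕ H' ∈ opts (G ⊕ H)
∈-⊕⁺ʳ G H i rewrite opts-⊕ G H = ∈-++⁺ʳ (map (_⊕ H) (opts G)) (∈-map⁺ (G ⊕_) i)

∈-⊕⁻ : ∀ {Z} G H → Z ∈ opts (G ⊕ H) →
       (Σ Game λ G' → G' ∈ opts G × Z ≡ G' ⊕ H) ⊎ (Σ Game λ H' → H' ∈ opts H × Z ≡ G ⊕ H')
∈-⊕⁻ G H i rewrite opts-⊕ G H with ∈-++⁻ (map (_⊕ H) (opts G)) i
... | inj₁ j = inj₁ (∈-map⁻ (_⊕ H) j)
... | inj₂ j = inj₂ (∈-map⁻ (G ⊕_) j)

act-⊕ʳ : ∀ G H → act H ≡ true → act (G ⊕ H) ≡ true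
act-⊕ʳ (mk _ a) (mk _ b) refl = ∨-zeroʳ a

anyP-∈ : ∀ {Z} gs → Z ∈ gs → isP Z ≡ true → anyP gs ≡ true
anyP-∈ (g ∷ gs) (here refl) p rewrite p = refl
anyP-∈ (g ∷ gs) (there i)   p rewrite anyP-∈ gs i p = ∨-zeroʳ (isP g)

anyP-∉ : ∀ gs → (∀ {Z} → Z ∈ gs → isP Z ≡ false) → anyP gs ≡ false
anyP-∉ []       n = refl
anyP-∉ (g ∷ gs) n rewrite n (here refl) = anyP-∉ gs (λ i → n (there i))

isP-option : ∀ {G'} G → act G ≡ true → G' ∈ opts G → isP G' ≡ true → isP G ≡ false
isP-option (mk gs true) refl i p rewrite anyP-∈ gs i p = refl

isP-noOption : ∀ G → (∀ {G'} → G' ∈ opts G → isP G' ≡ false) → isP G ≡ true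
isP-noOption (mk gs false) n = refl
isP-noOption (mk gs true)  n rewrite anyP-∉ gs n = refl

isP-⊕∗-option : ∀ {Z'} Z H → Z' ∈ opts (Z ⊕ (H ⊕ ∗)) → isP Z' ≡ true → isP (Z ⊕ (H ⊕ ∗)) ≡ false
isP-⊕∗-option Z H = isP-option (Z ⊕ (H ⊕ ∗)) (act-⊕ʳ Z (H ⊕ ∗) (act-⊕ʳ H ∗ refl))

mirror-isP : ∀ {G H} → G ≅ H → isP (G ⊕ (H ⊕ ∗)) ≡ true
mirror-isP {G} {H} (≅mk refl f g) = isP-noOption (G ⊕ (H ⊕ ∗)) reply
  where
  reply : ∀ {Z} → Z ∈ opts (G ⊕ (H ⊕ ∗)) → isP Z ≡ false
  reply i with ∈-⊕⁻ G (H ⊕ ∗) i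
  ... | inj₁ (G' , i' , refl) =
    let H' , j , e = f i' in
    isP-⊕∗-option G' H (∈-⊕⁺ʳ G' (H ⊕ ∗) (∈-⊕⁺ˡ H ∗ j)) (mirror-isP e)
  ... | inj₂ (Z' , i' , refl) with ∈-⊕⁻ H ∗ i'
  ...   | inj₁ (H' , j , refl) =
    let G' , j' , e = g j in
    isP-⊕∗-option G H' (∈-⊕⁺ˡ G (H' ⊕ ∗) j') (mirror-isP e)
  ...   | inj₂ (_ , () , _)

¬≈ᵍ-option : ∀ {G G' H} → G' ∈ opts G → G' ≅ H → ¬ H ≈ᵍ G
¬≈ᵍ-option {G} {H = H} i e H≈G with () ←
  begin
    true                 ≡⟨ sym (mirror-isP (≅-refl H)) ⟩
    isP (H ⊕ (H ⊕ ∗))    ≡⟨ H≈G (H ⊕ ∗) ⟩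
    isP (G ⊕ (H ⊕ ∗))    ≡⟨ isP-⊕∗-option G H (∈-⊕⁺ˡ G (H ⊕ ∗) i) (mirror-isP e) ⟩
    false                ∎

theorem3p45 : (G : Game) → Transitive G → Canonical G
theorem3p45 G (transitive trans-opts opts⊆) =
  canonical (λ i → theorem3p45 _ (trans-opts i)) irreversible
  where
  irreversible : ∀ {G'} → G' ∈ opts G → ¬ Reversible G G'
  irreversible i (G'' , j , G''≈G) =
    let Y , k , G''≅Y = opts⊆ i j in ¬≈ᵍ-option {G} k (≅-sym G''≅Y) G''≈G
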